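{- Let $\mathcal{L}$ be a first-order signature and $T$ an $\mathcal{L}$-Henkin theory. The following are equivalent: (1) $T$ is prime; (2) $T$ is a meet-prime element of the lattice $\mathfrak{T}$ of all $\mathcal{L}$-Henkin theories; (3) $T$ is a meet-irreducible element of $\mathfrak{T}$.
   Context: Signature $\mathcal{L}$: relation and function symbols of finite arity, at least one relation symbol; formulas built with $\neg,\wedge,\vee,\forall,\exists$; $\varphi[x\mapsto t]$ is capture-free substitution. The Henkin expansion $\mathrm{Hen}\,\mathcal{L}=\bigcup_i\mathcal{L}_i$, where $\mathcal{L}_0=\mathcal{L}$ and $\mathcal{L}_{i+1}$ adds to $\mathcal{L}_i$ a new constant $\mathsf{w}(\forall x\,\varphi)$ for each universal $\mathcal{L}_i$-formula $\forall x\,\varphi$ and $\mathsf{w}(\exists x\,\varphi)$ for each existential $\mathcal{L}_i$-formula $\exists x\,\varphi$; its formulas/terms are $\mathcal{L}$-Henkin formulas/terms. An $\mathcal{L}$-Henkin sequent $\Gamma\vartriangleright\Delta$ is a pair of finite sets of $\mathcal{L}$-Henkin formulas; $\varphi,\Gamma$ means $\{\varphi\}\cup\Gamma$. The calculus $\mathcal{ST}^H$ ($t$ ranges over $\mathcal{L}$-Henkin terms): axiom (ID) $\varphi\vartriangleright\varphi$; (WL), (WR) weakening on either side; bidirectional rules, usable top-down and bottom-up (from conclusion to any one premise), premises / conclusion: ($\wedge$L) $\varphi,\psi,\Gamma\vartriangleright\Delta$ / $\varphi\wedge\psi,\Gamma\vartriangleright\Delta$; ($\wedge$R) $\Gamma\vartriangleright\Delta,\varphi$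 and $\Gamma\vartriangleright\Delta,\psi$ / $\Gamma\vartriangleright\Delta,\varphi\wedge\psi$; ($\vee$L) $\varphi,\Gamma\vartriangleright\Delta$ and $\psi,\Gamma\vartriangleright\Delta$ / $\varphi\vee\psi,\Gamma\vartriangleright\Delta$; ($\vee$R) $\Gamma\vartriangleright\Delta,\varphi,\psi$ / $\Gamma\vartriangleright\Delta,\varphi\vee\psi$; ($\neg$R) $\varphi,\Gamma\vartriangleright\Delta$ / $\Gamma\vartriangleright\Delta,\neg\varphi$; ($\neg$L) $\Gamma\vartriangleright\Delta,\varphi$ / $\neg\varphi,\Gamma\vartriangleright\Delta$; ($\forall$LW) $\varphi[x\mapsto\mathsf{w}(\forall x\,\varphi)],\Gamma\vartriangleright\Delta$ / $\forall x\,\varphi,\Gamma\vartriangleright\Delta$; ($\forall$RW) $\Gamma\vartriangleright\Delta,\varphi[x\mapsto\mathsf{w}(\forall x\,\varphi)]$ / $\Gamma\vartriangleright\Delta,\forall x\,\varphi$; ($\exists$LW), ($\exists$RW) analogously with $\mathsf{w}(\exists x\,\varphi)$ and $\exists x\,\varphi$. One-directional rules: (UWI) $\varphi[x\mapsto t],\Gamma\vartriangleright\Delta$ / $\varphi[x\mapsto\mathsf{w}(\forall x\,\varphi)],\Gamma\vartriangleright\Delta$; (EWI) $\Gamma\vartriangleright\Delta,\varphi[x\mapsto t]$ / $\Gamma\vartriangleright\Delta,\varphi[x\mapsto\mathsf{w}(\exists x\,\varphi)]$; (EWE) $\varphi[x\mapsto\mathsf{w}(\exists x\,\varphi)],\Gamma\vartriangleright\Delta$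 / $\varphi[x\mapsto t],\Gamma\vartriangleright\Delta$; (UWE) $\Gamma\vartriangleright\Delta,\varphi[x\mapsto\mathsf{w}(\forall x\,\varphi)]$ / $\Gamma\vartriangleright\Delta,\varphi[x\mapsto t]$. No cut. $X\vdash_{\mathcal{ST}^H}S$: there is a finite derivation of $S$ whose leaves are (ID) instances or members of $X$. An $\mathcal{L}$-Henkin theory is a set of $\mathcal{L}$-Henkin sequents closed under $\vdash_{\mathcal{ST}^H}$; these form a complete lattice $\mathfrak{T}$ under inclusion, with meet given by intersection. $T$ is prime if whenever $\Gamma\vartriangleright\Delta\in T$ and $\Gamma\cup\Delta\ne\emptyset$, either $\gamma\vartriangleright\emptyset\in T$ for some $\gamma\in\Gamma$ or $\emptyset\vartriangleright\delta\in T$ for some $\delta\in\Delta$. An element $a$ of a lattice is meet-prime if for every nonempty finite $Y$ with $\bigwedge Y\le a$ there is $y\in Y$ with $y\le a$; it is meet-irreducible if $\bigwedge Y=a$ for a nonempty finite $Y$ implies $a\in Y$. -}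

module Defs where

open import Level using (0ℓ)
open import Data.Nat using (ℕ; zero; suc)
open import Data.Fin using (Fin)
open import Data.Vec using (Vec; []; _∷_)
open import Data.List using (List; []; _∷_; [_])
open import Data.List.Membership.Propositional using (_∈_)
open import Data.Product using (Σ; _×_; _,_)
open import Data.Sum using (_⊎_)
open import Relation.Nullary using (¬_)
open import Relation.Binary.PropositionalEquality using (_≡_)

record Signature : Set₁ where
  field
    RelSym   : Set
    FunSym   : Set
    relArity : RelSym → ℕ
    funArity : FunSym → ℕ
    someRel  : RelSym

-- The witness constant w(∀x φ) is  wA φ  (φ the body of the universal
-- formula), and w(∃x φ) is  wE φ.  Since every finite term/formula
-- built this way lies in some L_i, these inductive types are exactly
-- the terms/formulas of Hen L.  Witness constants are constants: they are
-- opaque to renaming and substitution.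

module _ (L : Signature) where
  open Signature L

  mutual
    data Term : Set where
      var : ℕ → Term
      fun : (f : FunSym) → Vec Term (funArity f) → Term
      wA  : Formula → Term
      wE  : Formula → Term

    data Formula : Set where
      rel  : (R : RelSym) → Vec Term (relArity R) → Formula
      ¬'_  : Formula → Formula
      _∧'_ : Formula → Formula → Formula
      _∨'_ : Formula → Formula → Formula
      ∀'_  : Formula → Formula
      ∃'_  : Formula → Formula

module _ {L : Signature} where
  open Signature L

  mutual
    renT : (ℕ → ℕ) → Term L → Term L
    renT ρ (var i)   = var (ρ i)
    renT ρ (fun f ts) = fun f (renTs ρ ts)
    renT ρ (wA φ)    = wA φ
    renT ρ (wE φ)    = wE φ

    renTs : ∀ {n} → (ℕ → ℕ) → Vec (Term L) n → Vec (Term L) n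
    renTs ρ []       = []
    renTs ρ (t ∷ ts) = renT ρ t ∷ renTs ρ ts

  exts : (ℕ → Term L) → ℕ → Term L
  exts σ zero    = var zero
  exts σ (suc i) = renT suc (σ i)

  mutual
    subT : (ℕ → Term L) → Term L → Term L
    subT σ (var i)    = σ i
    subT σ (fun f ts) = fun f (subTs σ ts)
    subT σ (wA φ)     = wA φ
    subT σ (wE φ)     = wE φ

    subTs : ∀ {n} → (ℕ → Term L) → Vec (Term L) n → Vec (Term L) n
    subTs σ []       = []
    subTs σ (t ∷ ts) = subT σ t ∷ subTs σ ts

  subF : (ℕ → Term L) → Formula L → Formula L
  subF σ (rel R ts) = rel R (subTs σ ts)
  subF σ (¬' φ)     = ¬' subF σ φ
  subF σ (φ ∧' ψ)   = subF σ φ ∧' subF σ ψ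
  subF σ (φ ∨' ψ)   = subF σ φ ∨' subF σ ψ
  subF σ (∀' φ)     = ∀' subF (exts σ) φ
  subF σ (∃' φ)     = ∃' subF (exts σ) φ

  single : Term L → ℕ → Term L
  single t zero    = t
  single t (suc i) = var i

  _[0↦_] : Formula L → Term L → Formula L
  φ [0↦ t ] = subF (single t) φ

-- Finite sets are represented by lists; the derivability
-- relation contains a structural rule identifying lists with the same
-- members, so sequents are effectively pairs of finite sets.

record Sequent (L : Signature) : Set where
  constructor _▷_
  field
    ante : List (Formula L)
    succ : List (Formula L)

_≋_ : {A : Set} → List A → List A → Set
xs ≋ ys = (∀ {x} → x ∈ xs → x ∈ ys) × (∀ {x} → x ∈ ys → x ∈ xs)

-- The calculus ST^H:  X ⊢ S  (leaves: ID instances or members of X).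
-- "↓" = top-down use, "↑" = bottom-up use (conclusion to one premise).

data _⊢_ {L : Signature} (X : Sequent L → Set) : Sequent L → Set where
  hyp   : ∀ {S} → X S → X ⊢ S
  ax    : ∀ {φ} → X ⊢ ([ φ ] ▷ [ φ ])
  sets  : ∀ {Γ Γ' Δ Δ'} → Γ ≋ Γ' → Δ ≋ Δ' → X ⊢ (Γ ▷ Δ) → X ⊢ (Γ' ▷ Δ')
  WL    : ∀ {Γ Δ φ} → X ⊢ (Γ ▷ Δ) → X ⊢ ((φ ∷ Γ) ▷ Δ)
  WR    : ∀ {Γ Δ φ} → X ⊢ (Γ ▷ Δ) → X ⊢ (Γ ▷ (φ ∷ Δ))
  ∧L↓   : ∀ {Γ Δ φ ψ} → X ⊢ ((φ ∷ ψ ∷ Γ) ▷ Δ) → X ⊢ (((φ ∧' ψ) ∷ Γ) ▷ Δ)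
  ∧L↑   : ∀ {Γ Δ φ ψ} → X ⊢ (((φ ∧' ψ) ∷ Γ) ▷ Δ) → X ⊢ ((φ ∷ ψ ∷ Γ) ▷ Δ)
  ∧R↓   : ∀ {Γ Δ φ ψ} → X ⊢ (Γ ▷ (φ ∷ Δ)) → X ⊢ (Γ ▷ (ψ ∷ Δ)) → X ⊢ (Γ ▷ ((φ ∧' ψ) ∷ Δ))
  ∧R↑₁  : ∀ {Γ Δ φ ψ} → X ⊢ (Γ ▷ ((φ ∧' ψ) ∷ Δ)) → X ⊢ (Γ ▷ (φ ∷ Δ))
  ∧R↑₂  : ∀ {Γ Δ φ ψ} → X ⊢ (Γ ▷ ((φ ∧' ψ) ∷ Δ)) → X ⊢ (Γ ▷ (ψ ∷ Δ))
  ∨L↓   : ∀ {Γ Δ φ ψ} → X ⊢ ((φ ∷ Γ) ▷ Δ) → X ⊢ ((ψ ∷ Γ) ▷ Δ) → X ⊢ (((φ ∨' ψ) ∷ Γ) ▷ Δ)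
  ∨L↑₁  : ∀ {Γ Δ φ ψ} → X ⊢ (((φ ∨' ψ) ∷ Γ) ▷ Δ) → X ⊢ ((φ ∷ Γ) ▷ Δ)
  ∨L↑₂  : ∀ {Γ Δ φ ψ} → X ⊢ (((φ ∨' ψ) ∷ Γ) ▷ Δ) → X ⊢ ((ψ ∷ Γ) ▷ Δ)
  ∨R↓   : ∀ {Γ Δ φ ψ} → X ⊢ (Γ ▷ (φ ∷ ψ ∷ Δ)) → X ⊢ (Γ ▷ ((φ ∨' ψ) ∷ Δ))
  ∨R↑   : ∀ {Γ Δ φ ψ} → X ⊢ (Γ ▷ ((φ ∨' ψ) ∷ Δ)) → X ⊢ (Γ ▷ (φ ∷ ψ ∷ Δ))
  ¬R↓   : ∀ {Γ Δ φ} → X ⊢ ((φ ∷ Γ) ▷ Δ) → X ⊢ (Γ ▷ ((¬' φ) ∷ Δ))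
  ¬R↑   : ∀ {Γ Δ φ} → X ⊢ (Γ ▷ ((¬' φ) ∷ Δ)) → X ⊢ ((φ ∷ Γ) ▷ Δ)
  ¬L↓   : ∀ {Γ Δ φ} → X ⊢ (Γ ▷ (φ ∷ Δ)) → X ⊢ (((¬' φ) ∷ Γ) ▷ Δ)
  ¬L↑   : ∀ {Γ Δ φ} → X ⊢ (((¬' φ) ∷ Γ) ▷ Δ) → X ⊢ (Γ ▷ (φ ∷ Δ))
  ∀LW↓  : ∀ {Γ Δ φ} → X ⊢ (((φ [0↦ wA φ ]) ∷ Γ) ▷ Δ) → X ⊢ (((∀' φ) ∷ Γ) ▷ Δ)
  ∀LW↑  : ∀ {Γ Δ φ} → X ⊢ (((∀' φ) ∷ Γ) ▷ Δ) → X ⊢ (((φ [0↦ wA φ ]) ∷ Γ) ▷ Δ)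
  ∀RW↓  : ∀ {Γ Δ φ} → X ⊢ (Γ ▷ ((φ [0↦ wA φ ]) ∷ Δ)) → X ⊢ (Γ ▷ ((∀' φ) ∷ Δ))
  ∀RW↑  : ∀ {Γ Δ φ} → X ⊢ (Γ ▷ ((∀' φ) ∷ Δ)) → X ⊢ (Γ ▷ ((φ [0↦ wA φ ]) ∷ Δ))
  ∃LW↓  : ∀ {Γ Δ φ} → X ⊢ (((φ [0↦ wE φ ]) ∷ Γ) ▷ Δ) → X ⊢ (((∃' φ) ∷ Γ) ▷ Δ)
  ∃LW↑  : ∀ {Γ Δ φ} → X ⊢ (((∃' φ) ∷ Γ) ▷ Δ) → X ⊢ (((φ [0↦ wE φ ]) ∷ Γ) ▷ Δ)
  ∃RW↓  : ∀ {Γ Δ φ} → X ⊢ (Γ ▷ ((φ [0↦ wE φ ]) ∷ Δ)) → X ⊢ (Γ ▷ ((∃' φ) ∷ Δ))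
  ∃RW↑  : ∀ {Γ Δ φ} → X ⊢ (Γ ▷ ((∃' φ) ∷ Δ)) → X ⊢ (Γ ▷ ((φ [0↦ wE φ ]) ∷ Δ))
  UWI   : ∀ {Γ Δ φ} (t : Term L) → X ⊢ (((φ [0↦ t ]) ∷ Γ) ▷ Δ) → X ⊢ (((φ [0↦ wA φ ]) ∷ Γ) ▷ Δ)
  EWI   : ∀ {Γ Δ φ} (t : Term L) → X ⊢ (Γ ▷ ((φ [0↦ t ]) ∷ Δ)) → X ⊢ (Γ ▷ ((φ [0↦ wE φ ]) ∷ Δ))
  EWE   : ∀ {Γ Δ φ} (t : Term L) → X ⊢ (((φ [0↦ wE φ ]) ∷ Γ) ▷ Δ) → X ⊢ (((φ [0↦ t ]) ∷ Γ) ▷ Δ)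
  UWE   : ∀ {Γ Δ φ} (t : Term L) → X ⊢ (Γ ▷ ((φ [0↦ wA φ ]) ∷ Δ)) → X ⊢ (Γ ▷ ((φ [0↦ t ]) ∷ Δ))

record Theory (L : Signature) : Set₁ where
  field
    _∋_    : Sequent L → Set
    closed : ∀ {S} → _∋_ ⊢ S → _∋_ S
open Theory public

module _ {L : Signature} where

  _≤_ : (Sequent L → Set) → (Sequent L → Set) → Set
  A ≤ B = ∀ S → A S → B S

  _≐_ : (Sequent L → Set) → (Sequent L → Set) → Set
  A ≐ B = (A ≤ B) × (B ≤ A)

  ⋀ : ∀ {n} → (Fin (suc n) → Theory L) → Sequent L → Set
  ⋀ Y S = ∀ i → _∋_ (Y i) S

  Prime : Theory L → Set
  Prime T = ∀ Γ Δ → _∋_ T (Γ ▷ Δ) → ¬ (Γ ≡ [] × Δ ≡ []) →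
            Σ (Formula L) (λ γ → γ ∈ Γ × _∋_ T ([ γ ] ▷ []))
          ⊎ Σ (Formula L) (λ δ → δ ∈ Δ × _∋_ T ([] ▷ [ δ ]))

  MeetPrime : Theory L → Set₁
  MeetPrime T = ∀ {n} (Y : Fin (suc n) → Theory L) →
                ⋀ Y ≤ _∋_ T → Σ (Fin (suc n)) (λ i → _∋_ (Y i) ≤ _∋_ T)

  MeetIrreducible : Theory L → Set₁
  MeetIrreducible T = ∀ {n} (Y : Fin (suc n) → Theory L) →
                      ⋀ Y ≐ _∋_ T → Σ (Fin (suc n)) (λ i → _∋_ (Y i) ≐ _∋_ T)

-- Write A ⊕ B for the componentwise union of two sequents. The calculus never looks at the
-- side formulas of a rule, so a derivation of S from X ∪ {A} can be rerun with B attached to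
-- every sequent; combining this with a derivation of S from X ∪ {B} shows that the theories
-- generated by T ∪ {A} and T ∪ {B} meet inside the one generated by T ∪ {A ⊕ B}. Hence if
-- T ∋ A ⊕ B, that meet lies below T, and meet-primality (or meet-irreducibility) of T gives
-- T ∋ A or T ∋ B; peeling formulas off one at a time, this ⊕-primality is primality.
-- Conversely, if a finite meet of theories Yᵢ lies below a ⊕-prime T but (classically) each
-- Yᵢ has a sequent outside T, the ⊕-sum of these sequents lies in every Yᵢ, hence in T, and
-- ⊕-primality puts one of them in T.
module Submission where

open import Defs
open import Level using (0ℓ)
open import Axiom.ExcludedMiddle using (ExcludedMiddle)
open import Data.Product using (_×_; Σ; _,_; proj₁; proj₂)
open import Function.Bundles using (_⇔_; mk⇔)
open import Function.Base using (_∘_)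
open import Data.Nat using (zero; suc)
open import Data.Fin using (Fin; zero; suc)
open import Data.Vec.Functional using () renaming ([] to []ᵛ; _∷_ to _∷ᵛ_)
open import Data.List using (List; []; _∷_; [_]; _++_)
open import Data.List.Properties using (++-identityʳ)
open import Data.List.Membership.Propositional using (_∈_)
open import Data.List.Membership.Propositional.Properties using (∈-++⁻)
open import Data.List.Relation.Unary.Any using (here; there)
open import Data.List.Relation.Binary.Subset.Propositional using (_⊆_)
open import Data.List.Relation.Binary.Subset.Propositional.Properties
  using (⊆-refl; ⊆-reflexive; ⊆-reflexive-↭; xs⊆xs++ys; xs⊆ys++xs; ++⁺ˡ)
open import Data.List.Relation.Binary.Permutation.Propositional.Properties using (++-comm)
open import Data.Sum as Sum using (_⊎_; inj₁; inj₂)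
open import Data.Empty using (⊥-elim)
open import Relation.Nullary using (¬_; yes; no; contradiction)
open import Relation.Nullary.Decidable using (decidable-stable)
open import Relation.Binary.PropositionalEquality using (_≡_; refl; sym)

module _ {L : Signature} where

  private
    Seq = Sequent L
    Pred = Seq → Set

  ∅ : Seq
  ∅ = [] ▷ []

  infixl 6 _⊕_
  _⊕_ : Seq → Seq → Seq
  (Γ ▷ Δ) ⊕ (Γ′ ▷ Δ′) = (Γ ++ Γ′) ▷ (Δ ++ Δ′)

  ⨁ : ∀ {n} → (Fin (suc n) → Seq) → Seq
  ⨁ {zero}  f = f zero
  ⨁ {suc n} f = f zero ⊕ ⨁ (f ∘ suc)

  ++-lub : {xs ys zs : List (Formula L)} → xs ⊆ zs → ys ⊆ zs → xs ++ ys ⊆ zs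
  ++-lub {xs} xs⊆zs ys⊆zs = Sum.[ xs⊆zs , ys⊆zs ]′ ∘ ∈-++⁻ xs

  ≋-reflexive : {xs ys : List (Formula L)} → xs ≡ ys → xs ≋ ys
  ≋-reflexive eq = ⊆-reflexive eq , ⊆-reflexive (sym eq)

  module _ {X : Pred} where

    ⊢-weaken : ∀ {Γ Δ Γ′ Δ′} → Γ ⊆ Γ′ → Δ ⊆ Δ′ → X ⊢ (Γ ▷ Δ) → X ⊢ (Γ′ ▷ Δ′)
    ⊢-weaken {Γ′ = Γ′} {Δ′} Γ⊆Γ′ Δ⊆Δ′ d =
      sets (++-lub ⊆-refl Γ⊆Γ′ , xs⊆xs++ys _ _) (++-lub ⊆-refl Δ⊆Δ′ , xs⊆xs++ys _ _)
           (weakenˡ Γ′ (weakenʳ Δ′ d))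
      where
      weakenˡ : ∀ {Γ Δ} Γ′ → X ⊢ (Γ ▷ Δ) → X ⊢ ((Γ′ ++ Γ) ▷ Δ)
      weakenˡ []       d = d
      weakenˡ (_ ∷ Γ′) d = WL (weakenˡ Γ′ d)
      weakenʳ : ∀ {Γ Δ} Δ′ → X ⊢ (Γ ▷ Δ) → X ⊢ (Γ ▷ (Δ′ ++ Δ))
      weakenʳ []       d = d
      weakenʳ (_ ∷ Δ′) d = WR (weakenʳ Δ′ d)

    ⊢-∅ : ∀ {S} → X ⊢ ∅ → X ⊢ S
    ⊢-∅ = ⊢-weaken (λ ()) (λ ())

    ⊢-⊕ˡ : ∀ {A B} → X ⊢ A → X ⊢ (A ⊕ B)
    ⊢-⊕ˡ = ⊢-weaken (xs⊆xs++ys _ _) (xs⊆xs++ys _ _)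

    ⊢-⊕ʳ : ∀ {A B} → X ⊢ B → X ⊢ (A ⊕ B)
    ⊢-⊕ʳ {Γ ▷ Δ} = ⊢-weaken (xs⊆ys++xs _ Γ) (xs⊆ys++xs _ Δ)

    ⊢-⨁ : ∀ {n} (f : Fin (suc n) → Seq) i → X ⊢ f i → X ⊢ ⨁ f
    ⊢-⨁ {zero}  f zero    d = d
    ⊢-⨁ {suc n} f zero    d = ⊢-⊕ˡ d
    ⊢-⨁ {suc n} f (suc i) d = ⊢-⊕ʳ (⊢-⨁ (f ∘ suc) i d)

    ⊢-⊕-comm : ∀ {A B} → X ⊢ (A ⊕ B) → X ⊢ (B ⊕ A)
    ⊢-⊕-comm {Γ ▷ Δ} {Γ′ ▷ Δ′} =
      sets (⊆-reflexive-↭ (++-comm Γ Γ′) , ⊆-reflexive-↭ (++-comm Γ′ Γ))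
           (⊆-reflexive-↭ (++-comm Δ Δ′) , ⊆-reflexive-↭ (++-comm Δ′ Δ))

    ⊢-⊕-contract : ∀ {S} → X ⊢ (S ⊕ S) → X ⊢ S
    ⊢-⊕-contract = sets (++-lub ⊆-refl ⊆-refl , xs⊆xs++ys _ _) (++-lub ⊆-refl ⊆-refl , xs⊆xs++ys _ _)

    ⊢-⊕∅⁻ : ∀ {S} → X ⊢ (S ⊕ ∅) → X ⊢ S
    ⊢-⊕∅⁻ {Γ ▷ Δ} = sets (≋-reflexive (++-identityʳ Γ)) (≋-reflexive (++-identityʳ Δ))

    ⊢-⊕∅⁺ : ∀ {S} → X ⊢ S → X ⊢ (S ⊕ ∅)
    ⊢-⊕∅⁺ {Γ ▷ Δ} = sets (≋-reflexive (sym (++-identityʳ Γ))) (≋-reflexive (sym (++-identityʳ Δ)))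

  ⊢-⊕-context : ∀ {X Z : Pred} C → (∀ {H} → X H → Z ⊢ (H ⊕ C)) → ∀ {S} → X ⊢ S → Z ⊢ (S ⊕ C)
  ⊢-⊕-context C h (hyp x)        = h x
  ⊢-⊕-context C h ax             = ⊢-⊕ˡ ax
  ⊢-⊕-context C h (sets (Γ⊆ , ⊇Γ) (Δ⊆ , ⊇Δ) d) =
    sets (++⁺ˡ _ Γ⊆ , ++⁺ˡ _ ⊇Γ) (++⁺ˡ _ Δ⊆ , ++⁺ˡ _ ⊇Δ) (⊢-⊕-context C h d)
  ⊢-⊕-context C h (WL d)         = WL (⊢-⊕-context C h d)
  ⊢-⊕-context C h (WR d)         = WR (⊢-⊕-context C h d)
  ⊢-⊕-context C h (∧L↓ d)        = ∧L↓ (⊢-⊕-context C h d)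
  ⊢-⊕-context C h (∧L↑ d)        = ∧L↑ (⊢-⊕-context C h d)
  ⊢-⊕-context C h (∧R↓ d e)      = ∧R↓ (⊢-⊕-context C h d) (⊢-⊕-context C h e)
  ⊢-⊕-context C h (∧R↑₁ d)       = ∧R↑₁ (⊢-⊕-context C h d)
  ⊢-⊕-context C h (∧R↑₂ d)       = ∧R↑₂ (⊢-⊕-context C h d)
  ⊢-⊕-context C h (∨L↓ d e)      = ∨L↓ (⊢-⊕-context C h d) (⊢-⊕-context C h e)
  ⊢-⊕-context C h (∨L↑₁ d)       = ∨L↑₁ (⊢-⊕-context C h d)
  ⊢-⊕-context C h (∨L↑₂ d)       = ∨L↑₂ (⊢-⊕-context C h d)
  ⊢-⊕-context C h (∨R↓ d)        = ∨R↓ (⊢-⊕-context C h d)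
  ⊢-⊕-context C h (∨R↑ d)        = ∨R↑ (⊢-⊕-context C h d)
  ⊢-⊕-context C h (¬R↓ d)        = ¬R↓ (⊢-⊕-context C h d)
  ⊢-⊕-context C h (¬R↑ d)        = ¬R↑ (⊢-⊕-context C h d)
  ⊢-⊕-context C h (¬L↓ d)        = ¬L↓ (⊢-⊕-context C h d)
  ⊢-⊕-context C h (¬L↑ d)        = ¬L↑ (⊢-⊕-context C h d)
  ⊢-⊕-context C h (∀LW↓ d)       = ∀LW↓ (⊢-⊕-context C h d)
  ⊢-⊕-context C h (∀LW↑ d)       = ∀LW↑ (⊢-⊕-context C h d)
  ⊢-⊕-context C h (∀RW↓ d)       = ∀RW↓ (⊢-⊕-context C h d)
  ⊢-⊕-context C h (∀RW↑ d)       = ∀RW↑ (⊢-⊕-context C h d)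
  ⊢-⊕-context C h (∃LW↓ d)       = ∃LW↓ (⊢-⊕-context C h d)
  ⊢-⊕-context C h (∃LW↑ d)       = ∃LW↑ (⊢-⊕-context C h d)
  ⊢-⊕-context C h (∃RW↓ d)       = ∃RW↓ (⊢-⊕-context C h d)
  ⊢-⊕-context C h (∃RW↑ d)       = ∃RW↑ (⊢-⊕-context C h d)
  ⊢-⊕-context C h (UWI t d)      = UWI t (⊢-⊕-context C h d)
  ⊢-⊕-context C h (EWI t d)      = EWI t (⊢-⊕-context C h d)
  ⊢-⊕-context C h (EWE t d)      = EWE t (⊢-⊕-context C h d)
  ⊢-⊕-context C h (UWE t d)      = UWE t (⊢-⊕-context C h d)

  ⊢-bind : ∀ {X Z : Pred} → (∀ {H} → X H → Z ⊢ H) → ∀ {S} → X ⊢ S → Z ⊢ S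
  ⊢-bind h = ⊢-⊕∅⁻ ∘ ⊢-⊕-context ∅ (⊢-⊕∅⁺ ∘ h)

  ⟨_⟩ : Pred → Theory L
  ⟨ X ⟩ = record { _∋_ = X ⊢_ ; closed = ⊢-bind (λ d → d) }

  _∪[_] : Pred → Seq → Pred
  (X ∪[ A ]) S = X S ⊎ S ≡ A

  -- Carry B along a derivation from A, then S along one from B, and contract S ⊕ S.
  ⊢-∪[⊕] : ∀ {X : Pred} A B {S} → (X ∪[ A ]) ⊢ S → (X ∪[ B ]) ⊢ S → (X ∪[ A ⊕ B ]) ⊢ S
  ⊢-∪[⊕] {X} A B {S} fromA fromB = ⊢-⊕-contract (⊢-⊕-context S fromB⊕S fromB)
    where
    S⊕B : (X ∪[ A ⊕ B ]) ⊢ (S ⊕ B)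
    S⊕B = ⊢-⊕-context B (λ { (inj₁ x) → ⊢-⊕ˡ (hyp (inj₁ x)) ; (inj₂ refl) → hyp (inj₂ refl) }) fromA
    fromB⊕S : ∀ {H} → (X ∪[ B ]) H → (X ∪[ A ⊕ B ]) ⊢ (H ⊕ S)
    fromB⊕S (inj₁ x)    = ⊢-⊕ˡ (hyp (inj₁ x))
    fromB⊕S (inj₂ refl) = ⊢-⊕-comm {A = S} S⊕B

  module _ (T : Theory L) where

    ∋-weaken : ∀ {Γ Δ Γ′ Δ′} → Γ ⊆ Γ′ → Δ ⊆ Δ′ → T ∋ (Γ ▷ Δ) → T ∋ (Γ′ ▷ Δ′)
    ∋-weaken Γ⊆Γ′ Δ⊆Δ′ t = closed T (⊢-weaken Γ⊆Γ′ Δ⊆Δ′ (hyp t))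

    ∋-∅ : ∀ {S} → T ∋ ∅ → T ∋ S
    ∋-∅ t = closed T (⊢-∅ (hyp t))

    HasAtom : List (Formula L) → List (Formula L) → Set
    HasAtom Γ Δ = Σ (Formula L) (λ γ → γ ∈ Γ × T ∋ ([ γ ] ▷ []))
                ⊎ Σ (Formula L) (λ δ → δ ∈ Δ × T ∋ ([] ▷ [ δ ]))

    Prime∅ : Set
    Prime∅ = ∀ Γ Δ → T ∋ (Γ ▷ Δ) → T ∋ ∅ ⊎ HasAtom Γ Δ

    ⊕-Prime : Set
    ⊕-Prime = ∀ A B → T ∋ (A ⊕ B) → T ∋ A ⊎ T ∋ B

    prime⇒prime∅ : Prime T → Prime∅
    prime⇒prime∅ prime []      []      t = inj₁ t
    prime⇒prime∅ prime (γ ∷ Γ) Δ       t = inj₂ (prime (γ ∷ Γ) Δ t λ { (() , _) })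
    prime⇒prime∅ prime []      (δ ∷ Δ) t = inj₂ (prime [] (δ ∷ Δ) t λ { (_ , ()) })

    prime∅⇒prime : Prime∅ → Prime T
    prime∅⇒prime prime∅ [] [] t nonempty = contradiction (refl , refl) nonempty
    prime∅⇒prime prime∅ (γ ∷ Γ) Δ t _ with prime∅ (γ ∷ Γ) Δ t
    ... | inj₁ t∅   = inj₁ (γ , here refl , ∋-∅ t∅)
    ... | inj₂ atom = atom
    prime∅⇒prime prime∅ [] (δ ∷ Δ) t _ with prime∅ [] (δ ∷ Δ) t
    ... | inj₁ t∅   = inj₂ (δ , here refl , ∋-∅ t∅)
    ... | inj₂ atom = atom

    prime∅⇒⊕-prime : Prime∅ → ⊕-Prime
    prime∅⇒⊕-prime prime∅ (Γ ▷ Δ) (Γ′ ▷ Δ′) t with prime∅ (Γ ++ Γ′) (Δ ++ Δ′) t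
    ... | inj₁ t∅ = inj₁ (∋-∅ t∅)
    ... | inj₂ (inj₁ (γ , γ∈ , tγ)) with ∈-++⁻ Γ γ∈
    ...   | inj₁ γ∈Γ  = inj₁ (∋-weaken (λ { (here refl) → γ∈Γ }) (λ ()) tγ)
    ...   | inj₂ γ∈Γ′ = inj₂ (∋-weaken (λ { (here refl) → γ∈Γ′ }) (λ ()) tγ)
    prime∅⇒⊕-prime prime∅ (Γ ▷ Δ) (Γ′ ▷ Δ′) t | inj₂ (inj₂ (δ , δ∈ , tδ)) with ∈-++⁻ Δ δ∈
    ...   | inj₁ δ∈Δ  = inj₁ (∋-weaken (λ ()) (λ { (here refl) → δ∈Δ }) tδ)
    ...   | inj₂ δ∈Δ′ = inj₂ (∋-weaken (λ ()) (λ { (here refl) → δ∈Δ′ }) tδ)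

    -- γ ∷ Γ ▷ Δ is literally ([ γ ] ▷ []) ⊕ (Γ ▷ Δ), so ⊕-primality peels off one formula at a time.
    ⊕-prime⇒prime∅ : ⊕-Prime → Prime∅
    ⊕-prime⇒prime∅ split []      []      t = inj₁ t
    ⊕-prime⇒prime∅ split (γ ∷ Γ) Δ       t with split ([ γ ] ▷ []) (Γ ▷ Δ) t
    ... | inj₁ tγ = inj₂ (inj₁ (γ , here refl , tγ))
    ... | inj₂ t′ with ⊕-prime⇒prime∅ split Γ Δ t′
    ...   | inj₁ t∅                      = inj₁ t∅
    ...   | inj₂ (inj₁ (γ′ , γ′∈ , tγ′)) = inj₂ (inj₁ (γ′ , there γ′∈ , tγ′))
    ...   | inj₂ (inj₂ atom)             = inj₂ (inj₂ atom)
    ⊕-prime⇒prime∅ split []      (δ ∷ Δ) t with split ([] ▷ [ δ ]) ([] ▷ Δ) t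
    ... | inj₁ tδ = inj₂ (inj₂ (δ , here refl , tδ))
    ... | inj₂ t′ with ⊕-prime⇒prime∅ split [] Δ t′
    ...   | inj₁ t∅                      = inj₁ t∅
    ...   | inj₂ (inj₁ (_ , () , _))
    ...   | inj₂ (inj₂ (δ′ , δ′∈ , tδ′)) = inj₂ (inj₂ (δ′ , there δ′∈ , tδ′))

    prime⇒⊕-prime : Prime T → ⊕-Prime
    prime⇒⊕-prime = prime∅⇒⊕-prime ∘ prime⇒prime∅

    ⊕-prime⇒prime : ⊕-Prime → Prime T
    ⊕-prime⇒prime = prime∅⇒prime ∘ ⊕-prime⇒prime∅

    ⊕-prime-⨁ : ⊕-Prime → ∀ {n} (f : Fin (suc n) → Seq) → T ∋ ⨁ f → Σ (Fin (suc n)) (λ i → T ∋ f i)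
    ⊕-prime-⨁ split {zero}  f t = zero , t
    ⊕-prime-⨁ split {suc n} f t with split (f zero) (⨁ (f ∘ suc)) t
    ... | inj₁ t₀ = zero , t₀
    ... | inj₂ t′ with ⊕-prime-⨁ split (f ∘ suc) t′
    ...   | i , tᵢ = suc i , tᵢ

    extend : Seq → Theory L
    extend A = ⟨ (T ∋_) ∪[ A ] ⟩

    meet-extend≤ : ∀ {A B} → T ∋ (A ⊕ B) → ⋀ (extend A ∷ᵛ extend B ∷ᵛ []ᵛ) ≤ (T ∋_)
    meet-extend≤ {A} {B} t S fromAB = closed T (⊢-bind fromT (⊢-∪[⊕] A B (fromAB zero) (fromAB (suc zero))))
      where
      fromT : ∀ {H} → ((T ∋_) ∪[ A ⊕ B ]) H → (T ∋_) ⊢ H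
      fromT (inj₁ x)    = hyp x
      fromT (inj₂ refl) = hyp t

    ≤meet-extend : ∀ {A B} → (T ∋_) ≤ ⋀ (extend A ∷ᵛ extend B ∷ᵛ []ᵛ)
    ≤meet-extend S t zero       = hyp (inj₁ t)
    ≤meet-extend S t (suc zero) = hyp (inj₁ t)

    meetPrime⇒⊕-prime : MeetPrime T → ⊕-Prime
    meetPrime⇒⊕-prime meetPrime A B t with meetPrime (extend A ∷ᵛ extend B ∷ᵛ []ᵛ) (meet-extend≤ t)
    ... | zero     , A≤T = inj₁ (A≤T A (hyp (inj₂ refl)))
    ... | suc zero , B≤T = inj₂ (B≤T B (hyp (inj₂ refl)))

    meetIrreducible⇒⊕-prime : MeetIrreducible T → ⊕-Prime
    meetIrreducible⇒⊕-prime meetIrr A B t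
      with meetIrr (extend A ∷ᵛ extend B ∷ᵛ []ᵛ) (meet-extend≤ t , ≤meet-extend)
    ... | zero     , (A≤T , _) = inj₁ (A≤T A (hyp (inj₂ refl)))
    ... | suc zero , (B≤T , _) = inj₂ (B≤T B (hyp (inj₂ refl)))

    meetPrime⇒meetIrreducible : MeetPrime T → MeetIrreducible T
    meetPrime⇒meetIrreducible meetPrime Y (⋀Y≤T , T≤⋀Y) with meetPrime Y ⋀Y≤T
    ... | i , Yᵢ≤T = i , (Yᵢ≤T , λ S x → T≤⋀Y S x i)

  _≰_ : Pred → Pred → Set
  A ≰ B = Σ Seq (λ S → A S × ¬ B S)

  ¬≤⇒≰ : ExcludedMiddle 0ℓ → {A B : Pred} → ¬ (A ≤ B) → A ≰ B
  ¬≤⇒≰ em {A} {B} ¬A≤B with em {A ≰ B}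
  ... | yes counterexample = counterexample
  ... | no  none           = contradiction (λ S a → decidable-stable em (λ ¬b → none (S , a , ¬b))) ¬A≤B

  ⊕-prime⇒¬∀≰ : (T : Theory L) → ⊕-Prime T → ∀ {n} (Y : Fin (suc n) → Theory L) →
                ⋀ Y ≤ (T ∋_) → ¬ (∀ i → (Y i ∋_) ≰ (T ∋_))
  ⊕-prime⇒¬∀≰ T split {n} Y ⋀Y≤T escape with ⊕-prime-⨁ T split counterexample T∋⨁
    where
    counterexample : Fin (suc n) → Seq
    counterexample = proj₁ ∘ escape
    T∋⨁ : T ∋ ⨁ counterexample
    T∋⨁ = ⋀Y≤T _ (λ i → closed (Y i) (⊢-⨁ counterexample i (hyp (proj₁ (proj₂ (escape i))))))
  ... | i , tᵢ = proj₂ (proj₂ (escape i)) tᵢ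

  ⊕-prime⇒meetPrime : ExcludedMiddle 0ℓ → (T : Theory L) → ⊕-Prime T → MeetPrime T
  ⊕-prime⇒meetPrime em T split {n} Y ⋀Y≤T with em {Σ (Fin (suc n)) (λ i → (Y i ∋_) ≤ (T ∋_))}
  ... | yes found = found
  ... | no  none  = ⊥-elim (⊕-prime⇒¬∀≰ T split Y ⋀Y≤T (λ i → ¬≤⇒≰ em (λ Yᵢ≤T → none (i , Yᵢ≤T))))

mainTheorem5 : ExcludedMiddle 0ℓ → (L : Signature) (T : Theory L) →
    (Prime T ⇔ MeetPrime T) × (MeetPrime T ⇔ MeetIrreducible T)
mainTheorem5 em L T =
  mk⇔ (⊕-prime⇒meetPrime em T ∘ prime⇒⊕-prime T) (⊕-prime⇒prime T ∘ meetPrime⇒⊕-prime T) ,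
  mk⇔ (meetPrime⇒meetIrreducible T) (⊕-prime⇒meetPrime em T ∘ meetIrreducible⇒⊕-prime T)
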